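{- For every odd $n\ge 3$, the cycle $C_n$ is not IRC-colorable.
   Context: Private neighbors. For $S\subseteq V(G)$ and $v\in S$, $pn[v,S]=N[v]\setminus\bigcup_{u\in S\setminus\{v\}}N[u]$, where $N[\cdot]$ is the closed neighborhood. $S$ is irredundant if $pn[v,S]\ne\emptyset$ for all $v\in S$. Rainbow committees and IRC-colorings. For a proper coloring of $G$ with nonempty color classes $V_1,\dots,V_k$, a rainbow committee is a set containing exactly one vertex of each color class. An irredundance compelling coloring (IRC-coloring) is a proper coloring in which every rainbow committee is an irredundant set. $G$ is IRC-colorable if it admits an IRC-coloring. -}

module Defs where

open import Data.Nat using (ℕ; suc; _∸_)
open import Data.Fin using (Fin; toℕ)
open import Data.Fin.Subset using (Subset; _∈_; _∉_)
open import Data.Product using (Σ; ∃; ∃-syntax; _×_)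
open import Data.Sum using (_⊎_; inj₁; inj₂)
open import Data.Product using (_,_)
open import Data.Nat.Properties using (1+n≢n)
open import Relation.Binary.PropositionalEquality using (sym; trans)
open import Relation.Binary.PropositionalEquality using (_≡_; _≢_)
open import Relation.Nullary using (¬_)
open import Function.Definitions using (Surjective)

record Graph : Set₁ where
  field
    n     : ℕ
    Adj   : Fin n → Fin n → Set
    adj-sym : ∀ {u v} → Adj u v → Adj v u
    irrefl : ∀ {v} → ¬ Adj v v
open Graph public

N[_]∋_ : (G : Graph) → Fin (n G) → Fin (n G) → Set
N[ G ]∋ v = λ w → w ≡ v ⊎ Adj G v w

PrivateNeighbor : (G : Graph) → Subset (n G) → Fin (n G) → Fin (n G) → Set
PrivateNeighbor G S v w =
  (N[ G ]∋ v) w × (∀ u → u ∈ S → u ≢ v → ¬ (N[ G ]∋ u) w)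

Irredundant : (G : Graph) → Subset (n G) → Set
Irredundant G S = ∀ v → v ∈ S → ∃[ w ] PrivateNeighbor G S v w

record ProperColoring (G : Graph) (k : ℕ) : Set where
  field
    col    : Fin (n G) → Fin k
    proper : ∀ {u v} → Adj G u v → col u ≢ col v
    onto   : Surjective _≡_ _≡_ col
open ProperColoring public

RainbowCommittee : (G : Graph) {k : ℕ} → ProperColoring G k → Subset (n G) → Set
RainbowCommittee G {k} c S =
  (∀ (i : Fin k) → ∃[ v ] (v ∈ S × col c v ≡ i)) ×
  (∀ (i : Fin k) u w → u ∈ S → w ∈ S → col c u ≡ i → col c w ≡ i → u ≡ w)

IsIRCColoring : (G : Graph) {k : ℕ} → ProperColoring G k → Set
IsIRCColoring G c = ∀ S → RainbowCommittee G c S → Irredundant G S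

IRCColorable : Graph → Set
IRCColorable G = ∃[ k ] Σ (ProperColoring G k) (IsIRCColoring G)

CycAdj : (m : ℕ) → Fin m → Fin m → Set
CycAdj m i j =
  toℕ j ≡ suc (toℕ i) ⊎ toℕ i ≡ suc (toℕ j) ⊎
  (toℕ i ≡ 0 × toℕ j ≡ m ∸ 1) ⊎ (toℕ j ≡ 0 × toℕ i ≡ m ∸ 1)

cycAdj-sym : ∀ {m} {i j : Fin m} → CycAdj m i j → CycAdj m j i
cycAdj-sym (inj₁ p) = inj₂ (inj₁ p)
cycAdj-sym (inj₂ (inj₁ p)) = inj₁ p
cycAdj-sym (inj₂ (inj₂ (inj₁ p))) = inj₂ (inj₂ (inj₂ p))
cycAdj-sym (inj₂ (inj₂ (inj₂ p))) = inj₂ (inj₂ (inj₁ p))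

cycAdj-irrefl : ∀ k {i : Fin (suc (suc (suc k)))} → ¬ CycAdj (suc (suc (suc k))) i i
cycAdj-irrefl k {i} (inj₁ p) = 1+n≢n (sym p)
cycAdj-irrefl k {i} (inj₂ (inj₁ p)) = 1+n≢n (sym p)
cycAdj-irrefl k {i} (inj₂ (inj₂ (inj₁ (p , q)))) with trans (sym p) q
... | ()
cycAdj-irrefl k {i} (inj₂ (inj₂ (inj₂ (p , q)))) with trans (sym p) q
... | ()

Cycle : (m : ℕ) → {k : ℕ} → m ≡ suc (suc (suc k)) → Graph
Cycle m {k} _≡_.refl = record
  { n = m ; Adj = CycAdj m ; adj-sym = cycAdj-sym ; irrefl = cycAdj-irrefl k }

{-# OPTIONS --safe #-}
-- If a vertex b has exactly two neighbours a and d of different colours, the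
-- colour classes of a, b, d are distinct, so some rainbow committee contains
-- all three; in it b has no private neighbour, since N[b] = {a, b, d} is
-- covered by N[a] ∪ N[d].  Hence in an IRC-colouring of a cycle any two
-- vertices at distance two share a colour.  Along 0, 2, 4, …, n − 1 (n odd)
-- this forces the adjacent vertices 0 and n − 1 to share a colour.
module Submission where

open import Defs
open import Data.Empty using (⊥-elim)
open import Data.Fin using (Fin; toℕ; _≟_)
open import Data.Fin.Properties using (toℕ-injective; toℕ-fromℕ<)
open import Data.Fin.Subset using (Subset; _∈_)
open import Data.Nat using (ℕ; zero; suc; _+_; _*_; _≤_; z≤n; s≤s)
open import Data.Nat.DivMod using (_mod_; m%n<n; m<n⇒m%n≡m)
open import Data.Nat.Divisibility using (_∣_; divides; ∣-refl; ∣m∣n⇒∣m+n)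
open import Data.Nat.Properties
  using (≤-refl; ≤-trans; m≤n+m; n≤1+n; suc-injective; <-irrefl; 1+n≢0)
open import Data.Product using (_,_; proj₁; proj₂; ∃-syntax)
open import Data.Sum using (_⊎_; inj₁; inj₂)
open import Data.Vec using (tabulate)
open import Data.Vec.Properties using (lookup⇒[]=; []=⇒lookup; lookup∘tabulate)
open import Relation.Nullary using (¬_; yes; no; does)
open import Relation.Nullary.Decidable using (dec-true; decidable-stable)
open import Relation.Binary.PropositionalEquality
  using (_≡_; _≢_; refl; sym; trans; cong; subst; module ≡-Reasoning)

module _ {G : Graph} {k : ℕ} (c : ProperColoring G k) where

  record ColourSection : Set where
    field
      pick     : Fin k → Fin (n G)
      col-pick : ∀ i → col c (pick i) ≡ i
  open ColourSection

  section : ColourSection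
  section = record
    { pick = λ i → proj₁ (onto c i) ; col-pick = λ i → proj₂ (onto c i) refl }

  redirect : ColourSection → Fin (n G) → ColourSection
  pick (redirect s v) i with i ≟ col c v
  ... | yes _ = v
  ... | no  _ = pick s i
  col-pick (redirect s v) i with i ≟ col c v
  ... | yes i≡cv = sym i≡cv
  ... | no  _    = col-pick s i

  redirect-at : ∀ s v → pick (redirect s v) (col c v) ≡ v
  redirect-at s v with col c v ≟ col c v
  ... | yes _  = refl
  ... | no  cv≢cv = ⊥-elim (cv≢cv refl)

  redirect-elsewhere : ∀ s v {i} → i ≢ col c v → pick (redirect s v) i ≡ pick s i
  redirect-elsewhere s v {i} i≢cv with i ≟ col c v
  ... | yes i≡cv = ⊥-elim (i≢cv i≡cv)
  ... | no  _    = refl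

  committee : ColourSection → Subset (n G)
  committee s = tabulate λ w → does (pick s (col c w) ≟ w)

  pick-fixed⇒∈committee : ∀ s {w} → pick s (col c w) ≡ w → w ∈ committee s
  pick-fixed⇒∈committee s {w} fixed =
    lookup⇒[]= w _ (trans (lookup∘tabulate _ w) (dec-true (pick s (col c w) ≟ w) fixed))

  ∈committee⇒pick-fixed : ∀ s {w} → w ∈ committee s → pick s (col c w) ≡ w
  ∈committee⇒pick-fixed s {w} w∈
    with pick s (col c w) ≟ w | trans (sym (lookup∘tabulate _ w)) ([]=⇒lookup w∈)
  ... | yes fixed | _  = fixed
  ... | no  _     | ()

  pick∈committee : ∀ s i → pick s i ∈ committee s
  pick∈committee s i = pick-fixed⇒∈committee s (cong (pick s) (col-pick s i))

  committee-rainbow : ∀ s → RainbowCommittee G c (committee s)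
  committee-rainbow s =
      (λ i → pick s i , pick∈committee s i , col-pick s i)
    , λ i u w u∈ w∈ cu≡i cw≡i → begin
        u                ≡⟨ ∈committee⇒pick-fixed s u∈ ⟨
        pick s (col c u) ≡⟨ cong (pick s) (trans cu≡i (sym cw≡i)) ⟩
        pick s (col c w) ≡⟨ ∈committee⇒pick-fixed s w∈ ⟩
        w                ∎
    where open ≡-Reasoning

  bichromatic-degree-two⇒¬IRC : ∀ {a b d} → Adj G a b → Adj G b d →
    col c a ≢ col c d → (∀ {w} → Adj G b w → w ≡ a ⊎ w ≡ d) → ¬ IsIRCColoring G c
  bichromatic-degree-two⇒¬IRC {a} {b} {d} ab bd ca≢cd neighbours irc =
    no-private-neighbour
      (irc (committee s) (committee-rainbow s) b (pick-fixed⇒∈committee s pick-b))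
    where
    s : ColourSection
    s = redirect (redirect (redirect section a) d) b

    pick-b : pick s (col c b) ≡ b
    pick-b = redirect-at _ b

    pick-d : pick s (col c d) ≡ d
    pick-d = trans (redirect-elsewhere _ b (λ cd≡cb → proper c bd (sym cd≡cb)))
                   (redirect-at _ d)

    pick-a : pick s (col c a) ≡ a
    pick-a = trans (redirect-elsewhere _ b (proper c ab))
                   (trans (redirect-elsewhere _ d ca≢cd) (redirect-at _ a))

    a≢b : a ≢ b
    a≢b a≡b = proper c ab (cong (col c) a≡b)

    d≢b : d ≢ b
    d≢b d≡b = proper c bd (cong (col c) (sym d≡b))

    no-private-neighbour : ¬ (∃[ w ] PrivateNeighbor G (committee s) b w)
    no-private-neighbour (w , inj₁ refl , pn) =
      pn a (pick-fixed⇒∈committee s pick-a) a≢b (inj₂ ab)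
    no-private-neighbour (w , inj₂ bw , pn) with neighbours bw
    ... | inj₁ w≡a = pn a (pick-fixed⇒∈committee s pick-a) a≢b (inj₁ w≡a)
    ... | inj₂ w≡d = pn d (pick-fixed⇒∈committee s pick-d) d≢b (inj₁ w≡d)

module _ (M : ℕ) where

  vertex : ℕ → Fin (suc M)
  vertex j = j mod suc M

  toℕ-vertex : ∀ {j} → j ≤ M → toℕ (vertex j) ≡ j
  toℕ-vertex {j} j≤M = trans (toℕ-fromℕ< (m%n<n j (suc M))) (m<n⇒m%n≡m (s≤s j≤M))

  consecutive-adjacent : ∀ {j} → suc j ≤ M →
    CycAdj (suc M) (vertex j) (vertex (suc j))
  consecutive-adjacent {j} j<M =
    inj₁ (trans (toℕ-vertex j<M) (cong suc (sym (toℕ-vertex (≤-trans (n≤1+n j) j<M)))))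

  ends-adjacent : CycAdj (suc M) (vertex 0) (vertex M)
  ends-adjacent = inj₂ (inj₂ (inj₁ (toℕ-vertex z≤n , toℕ-vertex ≤-refl)))

  interior-neighbours : ∀ {j w} → 2 + j ≤ M → CycAdj (suc M) (vertex (suc j)) w →
    w ≡ vertex j ⊎ w ≡ vertex (2 + j)
  interior-neighbours {j} 2+j≤M = λ where
      (inj₁ w≡2+j) → inj₂ (toℕ-injective
        (trans w≡2+j (trans (cong suc toℕ-middle) (sym (toℕ-vertex 2+j≤M)))))
      (inj₂ (inj₁ 1+j≡1+w)) → inj₁ (toℕ-injective
        (trans (suc-injective (trans (sym 1+j≡1+w) toℕ-middle))
               (sym (toℕ-vertex (≤-trans (n≤1+n j) 1+j≤M)))))
      (inj₂ (inj₂ (inj₁ (1+j≡0 , _)))) →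
        ⊥-elim (1+n≢0 (trans (sym toℕ-middle) 1+j≡0))
      (inj₂ (inj₂ (inj₂ (_ , 1+j≡M)))) →
        ⊥-elim (<-irrefl (trans (sym toℕ-middle) 1+j≡M) 2+j≤M)
    where
    1+j≤M : suc j ≤ M
    1+j≤M = ≤-trans (n≤1+n (suc j)) 2+j≤M

    toℕ-middle : toℕ (vertex (suc j)) ≡ suc j
    toℕ-middle = toℕ-vertex 1+j≤M

2∣-or-2∣suc : ∀ m → 2 ∣ m ⊎ 2 ∣ suc m
2∣-or-2∣suc zero = inj₁ (divides 0 refl)
2∣-or-2∣suc (suc m) with 2∣-or-2∣suc m
... | inj₁ 2∣m   = inj₂ (∣m∣n⇒∣m+n ∣-refl 2∣m)
... | inj₂ 2∣1+m = inj₁ 2∣1+m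

agree-at-multiples : ∀ {A : Set} (f : ℕ → A) (s M : ℕ) →
  (∀ j → s + j ≤ M → f j ≡ f (s + j)) → ∀ q → q * s ≤ M → f 0 ≡ f (q * s)
agree-at-multiples f s M step zero    _        = refl
agree-at-multiples f s M step (suc q) [1+q]s≤M =
  trans (agree-at-multiples f s M step q (≤-trans (m≤n+m (q * s) s) [1+q]s≤M))
        (step (q * s) [1+q]s≤M)

corollary4 : ∀ (k : ℕ) → ¬ (2 ∣ suc (suc (suc k))) →
    ¬ IRCColorable (Cycle (suc (suc (suc k))) {k} refl)
corollary4 k odd (K , c , irc) =
  proper c {vertex M 0} {vertex M M} (ends-adjacent M) colour0≡colourM
  where
  M : ℕ
  M = suc (suc k)

  colour : ℕ → Fin K
  colour j = col c (vertex M j)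

  two-apart : ∀ j → 2 + j ≤ M → colour j ≡ colour (2 + j)
  two-apart j 2+j≤M = decidable-stable (colour j ≟ colour (2 + j)) λ differ →
    bichromatic-degree-two⇒¬IRC c (consecutive-adjacent M (≤-trans (n≤1+n _) 2+j≤M))
      (consecutive-adjacent M 2+j≤M) differ (interior-neighbours M 2+j≤M) irc

  colour0≡colourM : colour 0 ≡ colour M
  colour0≡colourM with 2∣-or-2∣suc M
  ... | inj₂ 2∣n                = ⊥-elim (odd 2∣n)
  ... | inj₁ (divides q M≡q*2) =
    trans (agree-at-multiples colour 2 M two-apart q (subst (_≤ M) M≡q*2 ≤-refl))
          (cong colour (sym M≡q*2))
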